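{- Let $C$ be an $m\times n$ evolutionary stable configuration. Then there are no integers $i,j$ and $k\ge0$ (with all positions referred to below lying in $\{1,\dots,m\}\times\{1,\dots,n\}$) such that either (Type I) $C_{i-1,j-1}=0$, $C_{i,j}=0$, $C_{i+1,j+1}=0$, $C_{i+1,j+2}=1$, $C_{i+1,j+3+3t}=1$, $C_{i+1,j+4+3t}=0$, $C_{i+1,j+5+3t}=1$ for all $t=0,1,\dots,k$, and $C_{i,j+3k+3}=C_{i,j+3k+4}=C_{i,j+3k+5}=1$; or (Type II) $C_{i,j}=0$, $C_{i+1,j-1}=0$, $C_{i+1,j+1}=0$, $C_{i+1,j+2}=1$, $C_{i+1,j+3+3t}=1$, $C_{i+1,j+4+3t}=0$, $C_{i+1,j+5+3t}=1$ for all $t=0,1,\dots,k$, and $C_{i,j+3k+3}=C_{i,j+3k+4}=C_{i,j+3k+5}=1$.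
   Context: An $m\times n$ configuration is a $0$-$1$ matrix $C=(C_{i,j})$, $1\le i\le m$, $1\le j\le n$; row $1$ is the northernmost and row $m$ the southernmost, column $1$ the westernmost and column $n$ the easternmost; $C_{i,j}=1$ means lot $(i,j)$ is occupied by a house. A house at $(i,j)$ is blocked if $j>1$ and $C_{i,j-1}=1$, and $j<n$ and $C_{i,j+1}=1$, and $i<m$ and $C_{i+1,j}=1$. $C$ is permissible if no house is blocked; it is maximal if it is permissible and occupying any single empty lot yields a non-permissible configuration. A maximal configuration is resistant to predators if for every empty lot $(i,j)$, after setting $C_{i,j}=1$ the new house at $(i,j)$ is blocked; it is resistant to altruists if for every empty lot $(i,j)$, after setting $C_{i,j}=1$ some house at a position other than $(i,j)$ is blocked. An evolutionary stable (ES) configuration is a maximal configuration resistant to both predators and altruists. -}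

module Defs where

open import Data.Nat using (ℕ; suc; _<_; _≤_; _≟_)
import Data.Nat as N
open import Relation.Nullary using (yes; no)
open import Data.Integer as ℤ using (ℤ; +_)
open import Data.Fin using (Fin; zero; suc; toℕ; fromℕ<)
open import Data.Bool using (Bool; true; false)
open import Data.Product using (Σ; ∃; ∃-syntax; _×_; _,_)
open import Data.Sum using (_⊎_)
open import Relation.Binary.PropositionalEquality using (_≡_)
open import Relation.Nullary using (¬_)

-- An m×n configuration: C i j = true means lot (i,j) is occupied (C_{i,j}=1).
-- Fin indices are 0-based: Fin index r represents paper row r+1.
-- Row index increases southwards, column index increases eastwards.
Config : ℕ → ℕ → Set
Config m n = Fin m → Fin n → Bool

occupy : ∀ {m n} → Config m n → Fin m → Fin n → Config m n
occupy {m} {n} C i j i' j' with toℕ i ≟ toℕ i' | toℕ j ≟ toℕ j'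
... | yes _ | yes _ = true
... | _ | _ = C i' j'

Blocked : ∀ {m n} → Config m n → Fin m → Fin n → Set
Blocked {m} {n} C i j =
  C i j ≡ true ×
  (Σ (Fin n) λ w → suc (toℕ w) ≡ toℕ j × C i w ≡ true) ×
  (Σ (Fin n) λ e → toℕ e ≡ suc (toℕ j) × C i e ≡ true) ×
  (Σ (Fin m) λ s → toℕ s ≡ suc (toℕ i) × C s j ≡ true)

Permissible : ∀ {m n} → Config m n → Set
Permissible C = ∀ i j → ¬ Blocked C i j

Maximal : ∀ {m n} → Config m n → Set
Maximal C = Permissible C × (∀ i j → C i j ≡ false → ¬ Permissible (occupy C i j))

ResistantToPredators : ∀ {m n} → Config m n → Set
ResistantToPredators C = ∀ i j → C i j ≡ false → Blocked (occupy C i j) i j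

ResistantToAltruists : ∀ {m n} → Config m n → Set
ResistantToAltruists {m} {n} C = ∀ i j → C i j ≡ false →
  Σ (Fin m) λ i' → Σ (Fin n) λ j' → ¬ (i' ≡ i × j' ≡ j) × Blocked (occupy C i j) i' j'

EvolutionaryStable : ∀ {m n} → Config m n → Set
EvolutionaryStable C = Maximal C × ResistantToPredators C × ResistantToAltruists C

-- Entry lookup at integer (1-based, as in the paper) coordinates:
-- "C_{a,b} = v" means (a,b) lies in {1..m}×{1..n} and the entry there is v.
Entry : ∀ {m n} → Config m n → ℤ → ℤ → Bool → Set
Entry {m} {n} C a b v =
  Σ (Fin m) λ r → Σ (Fin n) λ c →
    a ≡ + suc (toℕ r) × b ≡ + suc (toℕ c) × C r c ≡ v

TypeI : ∀ {m n} → Config m n → ℤ → ℤ → ℕ → Set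
TypeI C i j k =
  Entry C (i ℤ.- + 1) (j ℤ.- + 1) false ×
  Entry C i j false ×
  Entry C (i ℤ.+ + 1) (j ℤ.+ + 1) false ×
  Entry C (i ℤ.+ + 1) (j ℤ.+ + 2) true ×
  (∀ t → t ≤ k →
     Entry C (i ℤ.+ + 1) (j ℤ.+ + (3 N.+ 3 N.* t)) true ×
     Entry C (i ℤ.+ + 1) (j ℤ.+ + (4 N.+ 3 N.* t)) false ×
     Entry C (i ℤ.+ + 1) (j ℤ.+ + (5 N.+ 3 N.* t)) true) ×
  Entry C i (j ℤ.+ + (3 N.* k N.+ 3)) true ×
  Entry C i (j ℤ.+ + (3 N.* k N.+ 4)) true ×
  Entry C i (j ℤ.+ + (3 N.* k N.+ 5)) true

TypeII : ∀ {m n} → Config m n → ℤ → ℤ → ℕ → Set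
TypeII C i j k =
  Entry C i j false ×
  Entry C (i ℤ.+ + 1) (j ℤ.- + 1) false ×
  Entry C (i ℤ.+ + 1) (j ℤ.+ + 1) false ×
  Entry C (i ℤ.+ + 1) (j ℤ.+ + 2) true ×
  (∀ t → t ≤ k →
     Entry C (i ℤ.+ + 1) (j ℤ.+ + (3 N.+ 3 N.* t)) true ×
     Entry C (i ℤ.+ + 1) (j ℤ.+ + (4 N.+ 3 N.* t)) false ×
     Entry C (i ℤ.+ + 1) (j ℤ.+ + (5 N.+ 3 N.* t)) true) ×
  Entry C i (j ℤ.+ + (3 N.* k N.+ 3)) true ×
  Entry C i (j ℤ.+ + (3 N.* k N.+ 4)) true ×
  Entry C i (j ℤ.+ + (3 N.* k N.+ 5)) true

{-# OPTIONS --safe #-}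
module Submission where

-- Both patterns contain a motif: a vacant lot, a run of blocks 0 1 1 in the row below it starting
-- one column further east, and a house above the last lot of the run.  Resistance to predators
-- makes the east and south neighbours of a vacant lot houses, hence also its north neighbour;
-- resistance to altruists puts three houses above a vacant lot whose south-west and south-east
-- lots are vacant.  Walking east along the run block by block, these facts force the row above the
-- motif to carry a run of blocks of its own, started right after a vacant lot (for Type II the walk
-- starts under the roof that altruism puts over the vacant corner).  The house at the end of the
-- motif makes the walk reach a block whose middle lot lies under a vacant lot; the lot north-west of
-- that one is then vacant with vacant lots south-west and south-east of it, so altruism roofs it,
-- and roof and run form a Type II pattern two rows above the motif.  Type II patterns thus climb
-- two rows at a time, which is absurd.

open import Defs
open import Data.Nat using (ℕ)
open import Data.Integer using (ℤ)
open import Data.Sum using (_⊎_)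
open import Data.Product using (Σ)
open import Relation.Nullary using (¬_)

open import Data.Bool using (Bool; true; false)
open import Data.Empty using (⊥-elim)
open import Data.Fin using (Fin; toℕ; fromℕ<)
open import Data.Fin.Properties using (toℕ-injective; toℕ<n; toℕ-fromℕ<)
open import Data.Integer as ℤ using (+_)
open import Data.Integer.Properties using (+-injective)
open import Data.List using (_∷_; [])
open import Data.Nat using (zero; suc; _+_; _*_; _<_; _≤_; z≤n; s≤s; _≟_)
open import Data.Nat.Properties using (suc-injective; +-comm; +-identityʳ; <⇒≤; n≤1+n; ≤-trans)
open import Data.Nat.Tactic.RingSolver using (solve)
open import Data.Product using (_×_; _,_; proj₁; proj₂)
open import Data.Sum using (inj₁; inj₂)
open import Relation.Binary.PropositionalEquality using (_≡_; refl; sym; trans; cong; subst)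
open import Relation.Nullary using (yes; no)

Tee : (ℕ → ℕ → Set) → ℕ → ℕ → Set
Tee Occupied a b = Occupied a b × Occupied a (suc b) × Occupied a (2 + b) × Occupied (suc a) (suc b)

map-tee : ∀ {O O′ : ℕ → ℕ → Set} → (∀ {a b} → O a b → O′ a b) → ∀ {a b} → Tee O a b → Tee O′ a b
map-tee f (w , h , e , s) = f w , f h , f e , f s

module Grid {m n : ℕ} (C : Config m n) where

  -- 0-based, unlike Entry: (a , b) lies in the grid and C has value v there.
  Lot : ℕ → ℕ → Bool → Set
  Lot a b v = Σ (Fin m) λ r → Σ (Fin n) λ c → toℕ r ≡ a × toℕ c ≡ b × C r c ≡ v

  Occupied Vacant : ℕ → ℕ → Set
  Occupied a b = Lot a b true
  Vacant a b = Lot a b false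

  row< : ∀ {a b v} → Lot a b v → a < m
  row< (r , _ , refl , _ , _) = toℕ<n r

  column< : ∀ {a b v} → Lot a b v → b < n
  column< (_ , c , _ , refl , _) = toℕ<n c

  lot-value : ∀ {a b v} → Lot a b v → ∀ r c → toℕ r ≡ a → toℕ c ≡ b → C r c ≡ v
  lot-value (r , c , refl , refl , h) r′ c′ p q
    rewrite toℕ-injective p | toℕ-injective q = h

  occupied⇒¬vacant : ∀ {a b} → Occupied a b → ¬ Vacant a b
  occupied⇒¬vacant (r , c , p , q , h) vac with trans (sym h) (lot-value vac r c p q)
  ... | ()

  occupied-or-vacant : ∀ {a b} → a < m → b < n → Occupied a b ⊎ Vacant a b
  occupied-or-vacant a<m b<n with C (fromℕ< a<m) (fromℕ< b<n) in eq
  ... | true  = inj₁ (fromℕ< a<m , fromℕ< b<n , toℕ-fromℕ< a<m , toℕ-fromℕ< b<n , eq)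
  ... | false = inj₂ (fromℕ< a<m , fromℕ< b<n , toℕ-fromℕ< a<m , toℕ-fromℕ< b<n , eq)

  ¬occupied⇒vacant : ∀ {a b} → a < m → b < n → ¬ Occupied a b → Vacant a b
  ¬occupied⇒vacant a<m b<n ¬occ with occupied-or-vacant a<m b<n
  ... | inj₁ occ = ⊥-elim (¬occ occ)
  ... | inj₂ vac = vac

  blocked⇒tee : ∀ {i j} → Blocked C i j → Σ ℕ λ b → toℕ j ≡ suc b × Tee Occupied (toℕ i) b
  blocked⇒tee {i} {j} (h , (w , w≡ , hw) , (e , e≡ , he) , (s , s≡ , hs)) =
    toℕ w , sym w≡ ,
    (i , w , refl , refl , hw) , (i , j , refl , sym w≡ , h) ,
    (i , e , refl , trans e≡ (cong suc (sym w≡)) , he) , (s , j , s≡ , sym w≡ , hs)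

  permissible⇒¬tee : Permissible C → ∀ {a b} → ¬ Tee Occupied a b
  permissible⇒¬tee permissible
    ( west@(_ , w , _ , w≡ , _) , (r , c , r≡ , c≡ , h)
    , east@(_ , e , _ , e≡ , _) , south@(s , _ , s≡ , _ , _)) =
    permissible r c
      (h , (w , trans (cong suc w≡) (sym c≡) , lot-value west r w r≡ w≡)
         , (e , trans e≡ (cong suc (sym c≡)) , lot-value east r e r≡ e≡)
         , (s , trans s≡ (cong suc (sym r≡)) , lot-value south s c s≡ c≡))

  -- Occupancy once the lot (a , b) has been occupied.
  Occupied⁺ : ℕ → ℕ → ℕ → ℕ → Set
  Occupied⁺ a b p q = (p ≡ a × q ≡ b) ⊎ Occupied p q

  occupied⁺⇒occupied : ∀ {a b p q} → Occupied⁺ a b p q → ¬ (p ≡ a × q ≡ b) → Occupied p q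
  occupied⁺⇒occupied (inj₁ new) ≢new = ⊥-elim (≢new new)
  occupied⁺⇒occupied (inj₂ occ) _ = occ

  Roof : ℕ → ℕ → Set
  Roof a b = Occupied a b × Occupied a (suc b) × Occupied a (2 + b)

  Gap : ℕ → ℕ → Set
  Gap a j = Vacant a (suc j) × Occupied a (2 + j) × Occupied a (3 + j)

  -- Row a reads 0 1 1 0 1 1 … 0 1 1 on the columns suc j , … , e.
  data Run (a : ℕ) : ℕ → ℕ → Set where
    []  : ∀ {j} → Run a j j
    _∷_ : ∀ {j e} → Gap a j → Run a (3 + j) e → Run a j e

  _∷ʳ_ : ∀ {a j e} → Run a j e → Gap a e → Run a j (3 + e)
  [] ∷ʳ gap = gap ∷ []
  (gap′ ∷ run) ∷ʳ gap = gap′ ∷ (run ∷ʳ gap)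

  run-of-gaps : ∀ {a} k {y} → (∀ t → t ≤ k → Gap a (y + 3 * t)) → Run a y (y + (3 * k + 3))
  run-of-gaps {a} zero {y} gaps =
    subst (Run a y) (+-comm 3 y) (subst (Gap a) (+-identityʳ y) (gaps 0 z≤n) ∷ [])
  run-of-gaps {a} (suc k) {y} gaps =
    subst (Run a y) end-≡ (subst (Gap a) (+-identityʳ y) (gaps 0 z≤n) ∷ run-of-gaps k gaps′)
    where
    end-≡ : 3 + y + (3 * k + 3) ≡ y + (3 * suc k + 3)
    end-≡ = solve (k ∷ y ∷ [])
    shift : ∀ t → y + 3 * suc t ≡ 3 + y + 3 * t
    shift t = solve (t ∷ y ∷ [])
    gaps′ : ∀ t → t ≤ k → Gap a (3 + y + 3 * t)
    gaps′ t t≤k = subst (Gap a) (shift t) (gaps (suc t) (s≤s t≤k))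

  -- What Type I and Type II have in common, without C_{i+1,j+3k+4} = 0 and
  -- C_{i,j+3k+4} = C_{i,j+3k+5} = 1, which the argument never uses.
  Motif : ℕ → ℕ → ℕ → Set
  Motif u j e = Vacant u j × Run (suc u) j e × Occupied u e

  -- In the paper's coordinates (i , j) is (v + 2 , c + 2) for TypeI′ v
  -- and (u + 1 , c + 2) for TypeII′ u.
  TypeI′ TypeII′ : ℕ → Set
  TypeI′ v = Σ ℕ λ c → Σ ℕ λ e → Motif (suc v) (suc c) e × Vacant v c
  TypeII′ u = Σ ℕ λ c → Σ ℕ λ e → Motif u (suc c) e × Vacant (suc u) c

  -- TypeI C i j k and TypeII C i j k are two entries followed by MotifEntries i j k.
  MotifEntries : ℤ → ℤ → ℕ → Set
  MotifEntries i j k =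
    Entry C (i ℤ.+ + 1) (j ℤ.+ + 1) false ×
    Entry C (i ℤ.+ + 1) (j ℤ.+ + 2) true ×
    (∀ t → t ≤ k →
       Entry C (i ℤ.+ + 1) (j ℤ.+ + (3 + 3 * t)) true ×
       Entry C (i ℤ.+ + 1) (j ℤ.+ + (4 + 3 * t)) false ×
       Entry C (i ℤ.+ + 1) (j ℤ.+ + (5 + 3 * t)) true) ×
    Entry C i (j ℤ.+ + (3 * k + 3)) true ×
    Entry C i (j ℤ.+ + (3 * k + 4)) true ×
    Entry C i (j ℤ.+ + (3 * k + 5)) true

  entry⇒lot : ∀ {a b v} → Entry C (+ suc a) (+ suc b) v → Lot a b v
  entry⇒lot (r , c , p , q , h) =
    r , c , suc-injective (+-injective (sym p)) , suc-injective (+-injective (sym q)) , h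

  entry-below⇒lot : ∀ {a b v} → Entry C (+ suc a ℤ.+ + 1) (+ suc b) v → Lot (suc a) b v
  entry-below⇒lot {a} {b} {v} entry = subst (λ a′ → Lot a′ b v) (+-comm a 1) (entry⇒lot entry)

  gap-at : ∀ {a b b₁ b₂ b₃} → Vacant a b₁ → Occupied a b₂ → Occupied a b₃ →
           b₁ ≡ suc b → b₂ ≡ 2 + b → b₃ ≡ 3 + b → Gap a b
  gap-at vac occ occ′ refl refl refl = vac , occ , occ′

  motif-of-entries : ∀ {x y k} → Entry C (+ suc x) (+ suc y) false →
                     MotifEntries (+ suc x) (+ suc y) k → Motif x y (y + (3 * k + 3))
  motif-of-entries {x} {y} {k} start (vac₁ , occ₂ , period , roof , _) =
    entry⇒lot start , run-of-gaps k gap , entry⇒lot roof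
    where
    gap : ∀ t → t ≤ k → Gap (suc x) (y + 3 * t)
    gap zero _ =
      gap-at {b = y + 3 * 0} (entry-below⇒lot vac₁) (entry-below⇒lot occ₂)
        (entry-below⇒lot (proj₁ (period 0 z≤n)))
        (solve (y ∷ [])) (solve (y ∷ [])) (solve (y ∷ []))
    gap (suc t) t<k with period t (≤-trans (n≤1+n t) t<k)
    ... | _ , vac , occ =
      gap-at {b = y + 3 * suc t} (entry-below⇒lot vac) (entry-below⇒lot occ)
        (entry-below⇒lot (proj₁ (period (suc t) t<k)))
        (solve (t ∷ y ∷ [])) (solve (t ∷ y ∷ [])) (solve (t ∷ y ∷ []))

  -- The refl patterns on the entries at column j ℤ.- + 1 go through because + suc y ℤ.- + 1
  -- computes to + y.
  typeI⇒typeI′ : ∀ {i j k} → TypeI C i j k → Σ ℕ TypeI′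
  typeI⇒typeI′ typeI@(_ , (_ , _ , refl , refl , _) , _) = from-lots typeI
    where
    from-lots : ∀ {x y k} → TypeI C (+ suc x) (+ suc y) k → Σ ℕ TypeI′
    from-lots ((r , c , refl , refl , nw) , start , rest) =
      toℕ r , toℕ c , _ , motif-of-entries start rest , (r , c , refl , refl , nw)

  typeII⇒typeII′ : ∀ {i j k} → TypeII C i j k → Σ ℕ TypeII′
  typeII⇒typeII′ typeII@((_ , _ , refl , refl , _) , _) = from-lots typeII
    where
    from-lots : ∀ {x y k} → TypeII C (+ suc x) (+ suc y) k → Σ ℕ TypeII′
    from-lots {x} (start , sw@(_ , _ , _ , refl , _) , rest) =
      x , _ , _ , motif-of-entries start rest , entry-below⇒lot sw

module _ {m n : ℕ} {C : Config m n} where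
  open Grid C

  occupy-occupied : ∀ {r c p q} → Grid.Occupied (occupy C r c) p q → Occupied⁺ (toℕ r) (toℕ c) p q
  occupy-occupied {r} {c} (p , q , refl , refl , h) with toℕ r ≟ toℕ p | toℕ c ≟ toℕ q
  ... | yes r≡p | yes c≡q = inj₁ (sym r≡p , sym c≡q)
  ... | yes _   | no _    = inj₂ (p , q , refl , refl , h)
  ... | no _    | _       = inj₂ (p , q , refl , refl , h)

  occupy-blocked⇒tee : ∀ {r c i j} → Blocked (occupy C r c) i j →
    Σ ℕ λ b → toℕ j ≡ suc b × Tee (Occupied⁺ (toℕ r) (toℕ c)) (toℕ i) b
  occupy-blocked⇒tee {r} {c} blocked with Grid.blocked⇒tee (occupy C r c) blocked
  ... | b , j≡ , tee = b , j≡ , map-tee {O = Grid.Occupied (occupy C r c)} occupy-occupied tee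

module Stable {m n : ℕ} {C : Config m n} (es : EvolutionaryStable C) where
  open Grid C

  ¬tee : ∀ {a b} → ¬ Tee Occupied a b
  ¬tee = permissible⇒¬tee (proj₁ (proj₁ es))

  predator-tee : ∀ {a b} → Vacant a b → Σ ℕ λ y → b ≡ suc y × Tee (Occupied⁺ a b) a y
  predator-tee (r , c , refl , refl , h) = occupy-blocked⇒tee (proj₁ (proj₂ es) r c h)

  altruist-tee : ∀ {a b} → Vacant a b →
    Σ ℕ λ x → Σ ℕ λ y → ¬ (x ≡ a × suc y ≡ b) × Tee (Occupied⁺ a b) x y
  altruist-tee (r , c , refl , refl , h) with proj₂ (proj₂ es) r c h
  ... | i , j , ij≢rc , blocked with occupy-blocked⇒tee blocked
  ... | y , j≡ , tee =
    toℕ i , y , (λ (i≡ , y≡) → ij≢rc (toℕ-injective i≡ , toℕ-injective (trans j≡ y≡))) , tee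

  east-of-vacant : ∀ {a b} → Vacant a b → Occupied a (suc b)
  east-of-vacant vac with predator-tee vac
  ... | _ , refl , (_ , _ , east , _) = occupied⁺⇒occupied east λ { (_ , ()) }

  south-of-vacant : ∀ {a b} → Vacant a b → Occupied (suc a) b
  south-of-vacant vac with predator-tee vac
  ... | _ , refl , (_ , _ , _ , south) = occupied⁺⇒occupied south λ { (() , _) }

  north-of-vacant : ∀ {a b} → Vacant (suc a) b → Occupied a b
  north-of-vacant vac with occupied-or-vacant (<⇒≤ (row< vac)) (column< vac)
  ... | inj₁ occ = occ
  ... | inj₂ vac′ = ⊥-elim (occupied⇒¬vacant (south-of-vacant vac′) vac)

  tee-centre-vacant : ∀ {a b} → Occupied a b → Occupied a (2 + b) → Occupied (suc a) (suc b) →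
                      Vacant a (suc b)
  tee-centre-vacant west east south =
    ¬occupied⇒vacant (row< west) (column< south) λ centre → ¬tee (west , centre , east , south)

  tee-east-vacant : ∀ {a b} → 2 + b < n → Occupied a b → Occupied a (suc b) →
                    Occupied (suc a) (suc b) → Vacant a (2 + b)
  tee-east-vacant 2+b<n west centre south =
    ¬occupied⇒vacant (row< west) 2+b<n λ east → ¬tee (west , centre , east , south)

  roof-of-tee : ∀ {a b x y} → Tee (Occupied⁺ a (suc b)) x y → ¬ (x ≡ a × suc y ≡ suc b) →
    Vacant (suc a) b → Vacant (suc a) (2 + b) → Σ ℕ λ a′ → a ≡ suc a′ × Roof a′ b
  roof-of-tee (west , centre , east , inj₁ (refl , refl)) _ _ _ =
    _ , refl , occupied⁺⇒occupied west (λ { (() , _) }) ,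
    occupied⁺⇒occupied centre (λ { (() , _) }) , occupied⁺⇒occupied east (λ { (() , _) })
  roof-of-tee (_ , inj₁ (refl , refl) , _ , _) ≢new _ _ = ⊥-elim (≢new (refl , refl))
  roof-of-tee (inj₁ (refl , refl) , _ , _ , inj₂ south) _ _ se = ⊥-elim (occupied⇒¬vacant south se)
  roof-of-tee (_ , _ , inj₁ (refl , refl) , inj₂ south) _ sw _ = ⊥-elim (occupied⇒¬vacant south sw)
  roof-of-tee (inj₂ west , inj₂ centre , inj₂ east , inj₂ south) _ _ _ =
    ⊥-elim (¬tee (west , centre , east , south))

  roof-over-vacant : ∀ {a b} → Vacant a (suc b) → Vacant (suc a) b → Vacant (suc a) (2 + b) →
    Σ ℕ λ a′ → a ≡ suc a′ × Roof a′ b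
  roof-over-vacant vac with altruist-tee vac
  ... | _ , _ , ≢new , tee = roof-of-tee tee ≢new

  -- The invariant on row v while walking east along a motif in row suc v.
  Ceiling : ℕ → ℕ → Set
  Ceiling v j = Occupied v (suc j) ⊎ Σ ℕ λ c → Vacant v c × Run v (suc c) j

  north-of-run : ∀ {a c j} → Occupied a (suc j) → Run (suc a) (suc c) j → Occupied a (2 + c)
  north-of-run occ [] = occ
  north-of-run _ (gap ∷ _) = north-of-vacant (proj₁ gap)

  typeII-under-roof : ∀ {a j} → Roof a j → Vacant (suc a) (suc j) → Ceiling (suc a) j → TypeII′ a
  typeII-under-roof _ vac (inj₁ occ) = ⊥-elim (occupied⇒¬vacant occ vac)
  typeII-under-roof {a} (occ₀ , occ₁ , _) _ (inj₂ (c , vac , run)) =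
    c , _ , (start , run , occ₀) , vac
    where
    start : Vacant a (suc c)
    start = tee-centre-vacant (north-of-vacant vac) (north-of-run occ₁ run) (east-of-vacant vac)

  typeII-above-gap : ∀ {v j} → Ceiling v j → Vacant (suc v) j → Occupied (suc v) (suc j) →
    Vacant (suc v) (2 + j) → Σ ℕ λ a → v ≡ suc a × TypeII′ a
  typeII-above-gap ceiling start occ₁ vac₂
    with centre ← tee-centre-vacant (north-of-vacant start) (north-of-vacant vac₂) occ₁
    with roof-over-vacant centre start vac₂
  ... | a , refl , roof = a , refl , typeII-under-roof roof centre ceiling

  ceiling-step : ∀ {v j} → Ceiling v j → Vacant (suc v) j → Occupied (suc v) (suc j) →
    Occupied (suc v) (2 + j) → Vacant (suc v) (3 + j) → Ceiling v (3 + j)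
  ceiling-step {v} {j} ceiling start occ₁ occ₂ vac₃
    with occupied-or-vacant (<⇒≤ (row< start)) (column< occ₁)
  ... | inj₁ occ = inj₂ (2 + j , tee-east-vacant (column< occ₂) (north-of-vacant start) occ occ₁ , [])
  ... | inj₂ vac = extend ceiling
    where
    extend : Ceiling v j → Ceiling v (3 + j)
    extend (inj₁ occ) = ⊥-elim (occupied⇒¬vacant occ vac)
    extend (inj₂ (c , vac′ , run)) =
      inj₂ (c , vac′ , run ∷ʳ (vac , east-of-vacant vac , north-of-vacant vac₃))

  typeII-above-motif : ∀ {v j e} → Vacant (suc v) j → Run (suc (suc v)) j e → Occupied (suc v) e →
    Ceiling v j → Σ ℕ λ a → v ≡ suc a × TypeII′ a
  typeII-above-motif start [] occ _ = ⊥-elim (occupied⇒¬vacant occ start)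
  typeII-above-motif {v} {j} start ((gap₁ , gap₂ , gap₃) ∷ run) occ ceiling
    with occupied-or-vacant (row< start) (column< gap₂)
  ... | inj₂ vac₂ = typeII-above-gap ceiling start (north-of-vacant gap₁) vac₂
  ... | inj₁ occ₂ = typeII-above-motif vac₃ run occ (ceiling-step ceiling start occ₁ occ₂ vac₃)
    where
    occ₁ : Occupied (suc v) (suc j)
    occ₁ = north-of-vacant gap₁
    vac₃ : Vacant (suc v) (3 + j)
    vac₃ = tee-east-vacant (column< gap₃) occ₁ occ₂ gap₂

  typeII-descent : ∀ {u} → TypeII′ u → Σ ℕ λ a → u ≡ 2 + a × TypeII′ a
  typeII-descent (_ , _ , (start , [] , occ) , _) = ⊥-elim (occupied⇒¬vacant occ start)
  typeII-descent (_ , _ , (start , gap ∷ run , occ) , sw) with roof-over-vacant start sw (proj₁ gap)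
  ... | _ , refl , (_ , _ , occ₂) with typeII-above-motif start (gap ∷ run) occ (inj₁ occ₂)
  ... | a , refl , typeII = a , refl , typeII

  no-typeII′ : ∀ u → ¬ TypeII′ u
  no-typeII′ u typeII with typeII-descent typeII
  no-typeII′ .(2 + a) _ | a , refl , typeII = no-typeII′ a typeII

  no-typeI′ : ∀ v → ¬ TypeI′ v
  no-typeI′ _ (c , _ , (start , run , occ) , nw)
    with typeII-above-motif start run occ (inj₂ (c , nw , []))
  ... | a , _ , typeII = no-typeII′ a typeII

lemma5p5 : ∀ {m n} (C : Config m n) → EvolutionaryStable C →
    ¬ (Σ ℤ λ i → Σ ℤ λ j → Σ ℕ λ k → TypeI C i j k ⊎ TypeII C i j k)
lemma5p5 C es (_ , _ , _ , inj₁ typeI) with Grid.typeI⇒typeI′ C typeI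
... | v , typeI′ = Stable.no-typeI′ es v typeI′
lemma5p5 C es (_ , _ , _ , inj₂ typeII) with Grid.typeII⇒typeII′ C typeII
... | u , typeII′ = Stable.no-typeII′ es u typeII′
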